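{- Fix positive integers $r,k<\infty$. Then there exists a finite integer $n$ such that the following holds. Let $C'$ be any $r$-coloring of the set of all $n$-families, and suppose there is a coloring $c$ of the non-empty subsets of $[n]$ such that $C'(\mathcal{I})=c(f(\mathcal{I}))$ for every $n$-family $\mathcal{I}$ satisfying $|f(\mathcal{I})|\le|I'|$ for all $I'\in\mathcal{I}$. Then there exist pairwise disjoint non-empty sets $I_1,\dots,I_k\subset[n]$ such that the collection \[\left\{\Big\{\textstyle\bigcup_{j\in J}I_j : J\in\mathcal{J}\Big\} \;:\; \mathcal{J}\text{ is an extreme }k\text{ -family}\right\}\] is monochromatic under $C'$.
   Context: $[m]=\{1,\dots,m\}$. An $m$-family is a non-empty family $\mathcal{I}$ of pairwise disjoint non-empty subsets of $[m]$. For an $m$-family $\mathcal{I}$, $f(\mathcal{I})$ denotes the unique member $I\in\mathcal{I}$ with $\max(I)>\max(I')$ for all other $I'\in\mathcal{I}$. A $k$-family $\mathcal{J}$ is extreme if $|\mathcal{J}|=1$ or every member of $\mathcal{J}$ is a singleton. (For pairwise disjoint non-empty $I_1,\dots,I_k\subset[n]$ and a $k$-family $\mathcal{J}$, the family $\{\bigcup_{j\in J}I_j:J\in\mathcal{J}\}$ is an $n$-family.) -}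

module Defs where

open import Data.Nat using (ℕ; zero; suc; _≤_; _<_)
open import Data.Fin using (Fin) renaming (zero to fzero; suc to fsuc)
open import Data.Fin.Subset using (Subset; _∈_; _∪_; ⊥; Nonempty; ∣_∣)
open import Data.Vec using (_∷_; [])
open import Data.Bool using (if_then_else_)
open import Data.List using (List; []; length)
open import Data.List.Relation.Unary.All using (All)
open import Data.List.Relation.Unary.AllPairs using (AllPairs)
import Data.List.Membership.Propositional as LM
open import Data.Product using (Σ; _×_)
import Data.Sum
open import Data.Empty renaming (⊥ to Void)
open import Relation.Binary.PropositionalEquality using (_≡_; _≢_)

Disjoint : ∀ {n} → Subset n → Subset n → Set
Disjoint A B = ∀ x → x ∈ A → x ∈ B → Void

-- An m-family, represented by a list of its members (the list has no
-- repeated entries automatically, since members are non-empty and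
-- pairwise disjoint).  Colourings of families are required to be
-- invariant under permutation of the list (see Statement).
IsFamily : ∀ {m} → List (Subset m) → Set
IsFamily L = (L ≢ []) × All Nonempty L × AllPairs Disjoint L

IsMax : ∀ {m} → Subset m → Fin m → Set
IsMax I x = x ∈ I × (∀ y → y ∈ I → Data.Fin._≤_ y x)

-- F = f(L): F is a member of L whose maximum exceeds the maximum of every
-- other member of L.
IsTop : ∀ {m} → List (Subset m) → Subset m → Set
IsTop L F = F LM.∈ L × Σ _ λ x → IsMax F x ×
  (∀ I' → I' LM.∈ L → I' ≢ F → ∀ y → IsMax I' y → Data.Fin._<_ y x)

unionOver : ∀ {k n} → (Fin k → Subset n) → Subset k → Subset n
unionOver {zero} I [] = ⊥
unionOver {suc k} I (b ∷ J) =
  (if b then I fzero else ⊥) ∪ unionOver (λ j → I (fsuc j)) J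

IsExtreme : ∀ {k} → List (Subset k) → Set
IsExtreme J = (length J ≡ 1) Data.Sum.⊎ All (λ A → ∣ A ∣ ≡ 1) J

-- Folkman's theorem gives disjoint non-empty sets X₁, …, X_k ⊆ [m] all of whose non-empty unions
-- have the same colour; it follows from Hilbert's cube lemma, which yields families in which the
-- colour of a union is that of its first member, and a pigeonhole on those colours.
-- The hypothesis on C′ only speaks about families whose top member is a smallest one. By Ramsey's
-- theorem there is a large H ⊆ [n] on which the colour of a set with at most m elements depends only
-- on its size, so the Xᵢ may be moved into H with larger blocks placed lower, without changing any
-- colour. In a family of singletons {Iⱼ} the top member is then a smallest one, so C′ of it is the
-- common colour; a family with one member is trivially of this kind.

module Submission where

open import Defs
open import Data.Nat using (ℕ; NonZero)
open import Data.Fin using (Fin)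
open import Data.Fin.Subset using (Subset; ∣_∣)
open import Data.List using (List; map)
open import Data.List.Relation.Unary.All using (All)
open import Data.List.Relation.Binary.Permutation.Propositional using (_↭_)
import Data.List.Membership.Propositional as LM
open import Data.Product using (Σ; _×_)
open import Relation.Binary.PropositionalEquality using (_≡_; _≢_)

open import Data.Nat using (zero; suc; _+_; _*_; _∸_; _^_; _≤_; _<_; z≤n; s≤s; _≟_; _≤?_)
open import Data.Nat.Properties
open import Data.Fin as Fin using (zero; suc; toℕ)
import Data.Fin.Properties as Finₚ
open import Data.Fin.Subset
  using (_∈_; _∉_; _⊆_; _∪_; _∩_; ∁; _─_; _-_; ⊥; ⊤; ⁅_⁆; Nonempty; inside; outside)
open import Data.Fin.Subset.Properties
  using (∉⊥; ⊆-antisym; x∈p∪q⁻; x∈p∪q⁺; x∈⁅x⁆; x∈⁅y⁆⇒x≡y; ∪-identityˡ; ∪-identityʳ; ∪-assoc;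
         ∣⊥∣≡0; ⊥⊆; ∣⊤∣≡n; ∣p∣≤n; p⊆q⇒∣p∣≤∣q∣; Empty-unique; nonempty?; _∈?_;
         x∈p∩q⁺; x∈p∩q⁻; p∩q⊆p; ∣⁅x⁆∣≡1; x∉⁅y⁆⇒x≢y; x∈p∧x≢y⇒x∈p-y; p─q⊆p; x∈∁p⇒x∉p)
open import Data.Vec using (_∷_; []; _++_; here; there; tabulate)
import Data.Vec.Properties as Vecₚ
open import Data.Bool using (Bool; true; false; _∨_; if_then_else_)
import Data.Bool.Properties as Boolₚ
open import Data.List using ([]; _∷_)
import Data.List.Relation.Unary.All as All
import Data.List.Relation.Unary.All.Properties as Allₚ
import Data.List.Relation.Unary.AllPairs as AllPairs
import Data.List.Relation.Unary.AllPairs.Properties as AllPairsₚ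
open import Data.List.Relation.Unary.Any using (here; there)
open import Data.List.Membership.Propositional.Properties using (∈-map⁻)
open import Data.Empty using (⊥-elim)
open import Data.Unit using (tt) renaming (⊤ to Unit)
open import Data.Sum using (inj₁; inj₂)
open import Data.Product using (_,_; proj₁; proj₂; ∃-syntax)
open import Function using (_∘_)
open import Function.Definitions using (Injective)
open import Relation.Binary.Definitions using (tri<; tri≈; tri>)
open import Relation.Binary.PropositionalEquality
  using (refl; sym; trans; cong; cong₂; subst; subst₂; module ≡-Reasoning)
open import Relation.Nullary using (Dec; yes; no; does)
open import Relation.Nullary.Decidable using (dec-true; dec-false)

∈-unionOver⁻ : ∀ {k n} (D : Fin k → Subset n) J {x} → x ∈ unionOver D J → ∃[ j ] j ∈ J × x ∈ D j
∈-unionOver⁻ {zero} D [] x∈ = ⊥-elim (∉⊥ x∈)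
∈-unionOver⁻ {suc k} D (b ∷ J) x∈ with b | x∈p∪q⁻ (if b then D zero else ⊥) (unionOver (D ∘ suc) J) x∈
... | true  | inj₁ x∈D₀ = zero , here , x∈D₀
... | false | inj₁ x∈⊥ = ⊥-elim (∉⊥ x∈⊥)
... | _     | inj₂ x∈U with ∈-unionOver⁻ (D ∘ suc) J x∈U
...   | j , j∈J , x∈Dj = suc j , there j∈J , x∈Dj

∈-unionOver⁺ : ∀ {k n} (D : Fin k → Subset n) J {x j} → j ∈ J → x ∈ D j → x ∈ unionOver D J
∈-unionOver⁺ D (true ∷ J) here x∈Dj = x∈p∪q⁺ (inj₁ x∈Dj)
∈-unionOver⁺ D (_ ∷ J) (there j∈J) x∈Dj = x∈p∪q⁺ (inj₂ (∈-unionOver⁺ (D ∘ suc) J j∈J x∈Dj))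

unionOver-∪ : ∀ {k n} (D : Fin k → Subset n) A B → unionOver D (A ∪ B) ≡ unionOver D A ∪ unionOver D B
unionOver-∪ D A B = ⊆-antisym to from
  where
  to : unionOver D (A ∪ B) ⊆ unionOver D A ∪ unionOver D B
  to x∈ with ∈-unionOver⁻ D (A ∪ B) x∈
  ... | j , j∈A∪B , x∈Dj with x∈p∪q⁻ A B j∈A∪B
  ...   | inj₁ j∈A = x∈p∪q⁺ (inj₁ (∈-unionOver⁺ D A j∈A x∈Dj))
  ...   | inj₂ j∈B = x∈p∪q⁺ (inj₂ (∈-unionOver⁺ D B j∈B x∈Dj))
  from : unionOver D A ∪ unionOver D B ⊆ unionOver D (A ∪ B)
  from x∈ with x∈p∪q⁻ (unionOver D A) (unionOver D B) x∈
  ... | inj₁ x∈A with ∈-unionOver⁻ D A x∈A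
  ...   | j , j∈A , x∈Dj = ∈-unionOver⁺ D (A ∪ B) (x∈p∪q⁺ (inj₁ j∈A)) x∈Dj
  from x∈ | inj₂ x∈B with ∈-unionOver⁻ D B x∈B
  ...   | j , j∈B , x∈Dj = ∈-unionOver⁺ D (A ∪ B) (x∈p∪q⁺ (inj₂ j∈B)) x∈Dj

unionOver-unionOver : ∀ {m k n} (D : Fin k → Subset n) (K : Fin m → Subset k) J →
  unionOver D (unionOver K J) ≡ unionOver (unionOver D ∘ K) J
unionOver-unionOver D K J = ⊆-antisym to from
  where
  to : unionOver D (unionOver K J) ⊆ unionOver (unionOver D ∘ K) J
  to x∈ with ∈-unionOver⁻ D (unionOver K J) x∈
  ... | j , j∈ , x∈Dj with ∈-unionOver⁻ K J j∈
  ...   | i , i∈J , j∈Ki = ∈-unionOver⁺ (unionOver D ∘ K) J i∈J (∈-unionOver⁺ D (K i) j∈Ki x∈Dj)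
  from : unionOver (unionOver D ∘ K) J ⊆ unionOver D (unionOver K J)
  from x∈ with ∈-unionOver⁻ (unionOver D ∘ K) J x∈
  ... | i , i∈J , x∈ with ∈-unionOver⁻ D (K i) x∈
  ...   | j , j∈Ki , x∈Dj = ∈-unionOver⁺ D (unionOver K J) (∈-unionOver⁺ K J i∈J j∈Ki) x∈Dj

unionOver-⊥ʳ : ∀ {k n} (D : Fin k → Subset n) → unionOver D ⊥ ≡ ⊥
unionOver-⊥ʳ D = Empty-unique λ (x , x∈) → let j , j∈⊥ , _ = ∈-unionOver⁻ D ⊥ x∈ in ∉⊥ j∈⊥

unionOver-⊥ˡ : ∀ {k n} J → unionOver {k} {n} (λ _ → ⊥) J ≡ ⊥
unionOver-⊥ˡ J = Empty-unique λ (x , x∈) → let _ , _ , x∈⊥ = ∈-unionOver⁻ (λ _ → ⊥) J x∈ in ∉⊥ x∈⊥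

unionOver-⁅⁆ : ∀ {k n} (D : Fin k → Subset n) j → unionOver D ⁅ j ⁆ ≡ D j
unionOver-⁅⁆ D j = ⊆-antisym to (∈-unionOver⁺ D ⁅ j ⁆ (x∈⁅x⁆ j))
  where
  to : unionOver D ⁅ j ⁆ ⊆ D j
  to x∈ with ∈-unionOver⁻ D ⁅ j ⁆ x∈
  ... | i , i∈⁅j⁆ , x∈Di rewrite x∈⁅y⁆⇒x≡y j i∈⁅j⁆ = x∈Di

unionOver-cong : ∀ {k n} {D D′ : Fin k → Subset n} → (∀ i → D i ≡ D′ i) → ∀ J → unionOver D J ≡ unionOver D′ J
unionOver-cong {zero} D≡D′ [] = refl
unionOver-cong {suc k} D≡D′ (b ∷ J) =
  cong₂ (λ D₀ U → (if b then D₀ else ⊥) ∪ U) (D≡D′ zero) (unionOver-cong (D≡D′ ∘ suc) J)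

⊥-++ : ∀ m {n} → ⊥ {m + n} ≡ ⊥ {m} ++ ⊥ {n}
⊥-++ zero = refl
⊥-++ (suc m) = cong (outside ∷_) (⊥-++ m)

∪-++ : ∀ {m n} (X X′ : Subset m) (Y Y′ : Subset n) → (X ++ Y) ∪ (X′ ++ Y′) ≡ (X ∪ X′) ++ (Y ∪ Y′)
∪-++ X X′ Y Y′ = Vecₚ.zipWith-++ _∨_ X Y X′ Y′

unionOver-++ : ∀ {k m n} (A : Fin k → Subset m) (B : Fin k → Subset n) J →
  unionOver (λ i → A i ++ B i) J ≡ unionOver A J ++ unionOver B J
unionOver-++ {zero} {m} A B [] = ⊥-++ m
unionOver-++ {suc k} {m} A B (b ∷ J) = begin
  (if b then A zero ++ B zero else ⊥) ∪ unionOver (λ i → A (suc i) ++ B (suc i)) J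
    ≡⟨ cong₂ _∪_ (if-++ b) (unionOver-++ (A ∘ suc) (B ∘ suc) J) ⟩
  ((if b then A zero else ⊥) ++ (if b then B zero else ⊥)) ∪ (unionOver (A ∘ suc) J ++ unionOver (B ∘ suc) J)
    ≡⟨ ∪-++ (if b then A zero else ⊥) _ _ _ ⟩
  ((if b then A zero else ⊥) ∪ unionOver (A ∘ suc) J) ++ ((if b then B zero else ⊥) ∪ unionOver (B ∘ suc) J) ∎
  where
  open ≡-Reasoning
  if-++ : ∀ b → (if b then A zero ++ B zero else ⊥) ≡ (if b then A zero else ⊥) ++ (if b then B zero else ⊥)
  if-++ true = refl
  if-++ false = ⊥-++ m

unionOver-nonempty : ∀ {k n} (D : Fin k → Subset n) J → (∀ j → Nonempty (D j)) → Nonempty J → Nonempty (unionOver D J)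
unionOver-nonempty D J D-ne (j , j∈J) = let x , x∈Dj = D-ne j in x , ∈-unionOver⁺ D J j∈J x∈Dj

unionOver-disjoint : ∀ {k n} (D : Fin k → Subset n) → (∀ i j → i ≢ j → Disjoint (D i) (D j)) →
  ∀ A B → Disjoint A B → Disjoint (unionOver D A) (unionOver D B)
unionOver-disjoint D D-dis A B A#B x x∈A x∈B with ∈-unionOver⁻ D A x∈A | ∈-unionOver⁻ D B x∈B
... | i , i∈A , x∈Di | j , j∈B , x∈Dj with i Fin.≟ j
...   | yes refl = A#B i i∈A j∈B
...   | no i≢j = D-dis i j i≢j x x∈Di x∈Dj

⁅⁆-nonempty : ∀ {n} (x : Fin n) → Nonempty ⁅ x ⁆
⁅⁆-nonempty x = x , x∈⁅x⁆ x

x∈p⇒0<∣p∣ : ∀ {n} {p : Subset n} {x} → x ∈ p → 0 < ∣ p ∣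
x∈p⇒0<∣p∣ {p = p} {x} x∈p = subst (_≤ ∣ p ∣) (∣⁅x⁆∣≡1 x) (p⊆q⇒∣p∣≤∣q∣ ⁅x⁆⊆p)
  where
  ⁅x⁆⊆p : ⁅ x ⁆ ⊆ p
  ⁅x⁆⊆p y∈⁅x⁆ = subst (_∈ p) (sym (x∈⁅y⁆⇒x≡y x y∈⁅x⁆)) x∈p

∣p∣≡0⇒p≡⊥ : ∀ {n} {p : Subset n} → ∣ p ∣ ≡ 0 → p ≡ ⊥
∣p∣≡0⇒p≡⊥ ∣p∣≡0 = Empty-unique λ (x , x∈p) → <⇒≢ (x∈p⇒0<∣p∣ x∈p) (sym ∣p∣≡0)

0<∣p∣⇒nonempty : ∀ {n} (p : Subset n) → 0 < ∣ p ∣ → Nonempty p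
0<∣p∣⇒nonempty {n} p 0<∣p∣ with nonempty? p
... | yes ne = ne
... | no ¬ne = ⊥-elim (<⇒≢ 0<∣p∣ (sym (trans (cong ∣_∣ (Empty-unique ¬ne)) (∣⊥∣≡0 n))))

∣⁅x⁆∪p∣ : ∀ {n} {x : Fin n} (p : Subset n) → x ∉ p → ∣ ⁅ x ⁆ ∪ p ∣ ≡ suc ∣ p ∣
∣⁅x⁆∪p∣ {x = zero} (true ∷ p) x∉p = ⊥-elim (x∉p here)
∣⁅x⁆∪p∣ {x = zero} (false ∷ p) x∉p = cong (suc ∘ ∣_∣) (∪-identityˡ p)
∣⁅x⁆∪p∣ {x = suc x} (true ∷ p) x∉p = cong suc (∣⁅x⁆∪p∣ p (x∉p ∘ there))
∣⁅x⁆∪p∣ {x = suc x} (false ∷ p) x∉p = ∣⁅x⁆∪p∣ p (x∉p ∘ there)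

x∈p─q⇒x∉q : ∀ {n} {p q : Subset n} {x} → x ∈ p ─ q → x ∉ q
x∈p─q⇒x∉q {p = _ ∷ p} {true ∷ q} (there x∈) (there x∈q) = x∈p─q⇒x∉q {p = p} x∈ x∈q
x∈p─q⇒x∉q {p = _ ∷ p} {false ∷ q} (there x∈) (there x∈q) = x∈p─q⇒x∉q {p = p} x∈ x∈q
x∈p─q⇒x∉q {p = true ∷ p} {false ∷ q} here ()

p≡⁅x⁆∪p-x : ∀ {n} {p : Subset n} {x} → x ∈ p → p ≡ ⁅ x ⁆ ∪ (p - x)
p≡⁅x⁆∪p-x {p = p} {x} x∈p = ⊆-antisym to from
  where
  to : p ⊆ ⁅ x ⁆ ∪ (p - x)
  to {y} y∈p with y Fin.≟ x
  ... | yes refl = x∈p∪q⁺ (inj₁ (x∈⁅x⁆ x))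
  ... | no y≢x = x∈p∪q⁺ (inj₂ (x∈p∧x≢y⇒x∈p-y y∈p y≢x))
  from : ⁅ x ⁆ ∪ (p - x) ⊆ p
  from y∈ with x∈p∪q⁻ ⁅ x ⁆ (p - x) y∈
  ... | inj₁ y∈⁅x⁆ = subst (_∈ p) (sym (x∈⁅y⁆⇒x≡y x y∈⁅x⁆)) x∈p
  ... | inj₂ y∈p-x = p─q⊆p p ⁅ x ⁆ y∈p-x

x∈⁅y⁆∪p∧x≢y⇒x∈p : ∀ {n} {p : Subset n} {x y} → x ∈ ⁅ y ⁆ ∪ p → x ≢ y → x ∈ p
x∈⁅y⁆∪p∧x≢y⇒x∈p {p = p} {y = y} x∈ x≢y with x∈p∪q⁻ ⁅ y ⁆ p x∈
... | inj₁ x∈⁅y⁆ = ⊥-elim (x≢y (x∈⁅y⁆⇒x≡y y x∈⁅y⁆))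
... | inj₂ x∈p = x∈p

∣p∣≡1+∣p-x∣ : ∀ {n} {p : Subset n} {x} → x ∈ p → ∣ p ∣ ≡ suc ∣ p - x ∣
∣p∣≡1+∣p-x∣ {p = p} {x} x∈p =
  trans (cong ∣_∣ (p≡⁅x⁆∪p-x x∈p)) (∣⁅x⁆∪p∣ (p - x) (λ x∈p-x → x∈p─q⇒x∉q {p = p} x∈p-x (x∈⁅x⁆ x)))

image : ∀ {k n} → (Fin k → Fin n) → Subset k → Subset n
image f = unionOver (⁅_⁆ ∘ f)

∈-image⁻ : ∀ {k n} (f : Fin k → Fin n) A {y} → y ∈ image f A → ∃[ x ] x ∈ A × y ≡ f x
∈-image⁻ f A y∈ = let x , x∈A , y∈⁅fx⁆ = ∈-unionOver⁻ (⁅_⁆ ∘ f) A y∈ in x , x∈A , x∈⁅y⁆⇒x≡y (f x) y∈⁅fx⁆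

image-⊆ : ∀ {k n} (f : Fin k → Fin n) {H} → (∀ x → f x ∈ H) → ∀ A → image f A ⊆ H
image-⊆ f {H} f∈H A y∈ = let x , _ , y≡fx = ∈-image⁻ f A y∈ in subst (_∈ H) (sym y≡fx) (f∈H x)

image-nonempty : ∀ {k n} (f : Fin k → Fin n) A → Nonempty A → Nonempty (image f A)
image-nonempty f A = unionOver-nonempty (⁅_⁆ ∘ f) A (⁅⁆-nonempty ∘ f)

image-disjoint : ∀ {k n} (f : Fin k → Fin n) → Injective _≡_ _≡_ f →
  ∀ A B → Disjoint A B → Disjoint (image f A) (image f B)
image-disjoint f f-inj = unionOver-disjoint (⁅_⁆ ∘ f) ⁅fi⁆#⁅fj⁆
  where
  ⁅fi⁆#⁅fj⁆ : ∀ i j → i ≢ j → Disjoint ⁅ f i ⁆ ⁅ f j ⁆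
  ⁅fi⁆#⁅fj⁆ i j i≢j y y∈⁅fi⁆ y∈⁅fj⁆ =
    i≢j (f-inj (trans (sym (x∈⁅y⁆⇒x≡y (f i) y∈⁅fi⁆)) (x∈⁅y⁆⇒x≡y (f j) y∈⁅fj⁆)))

∣image∣ : ∀ {k n} (f : Fin k → Fin n) → Injective _≡_ _≡_ f → ∀ A → ∣ image f A ∣ ≡ ∣ A ∣
∣image∣ {zero} {n} f f-inj [] = ∣⊥∣≡0 n
∣image∣ {suc k} f f-inj (true ∷ A) =
  trans (∣⁅x⁆∪p∣ (image (f ∘ suc) A) f₀∉) (cong suc (∣image∣ (f ∘ suc) (Finₚ.suc-injective ∘ f-inj) A))
  where
  f₀∉ : f zero ∉ image (f ∘ suc) A
  f₀∉ f₀∈ = let x , _ , f₀≡ = ∈-image⁻ (f ∘ suc) A f₀∈ in Finₚ.0≢1+n (f-inj f₀≡)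
∣image∣ {suc k} f f-inj (false ∷ A) =
  trans (cong ∣_∣ (∪-identityˡ (image (f ∘ suc) A))) (∣image∣ (f ∘ suc) (Finₚ.suc-injective ∘ f-inj) A)

unionOver-image : ∀ {m k n} (D : Fin k → Subset n) (h : Fin m → Fin k) J →
  unionOver D (image h J) ≡ unionOver (D ∘ h) J
unionOver-image D h J = trans (unionOver-unionOver D (⁅_⁆ ∘ h) J) (unionOver-cong (unionOver-⁅⁆ D ∘ h) J)

fibre : ∀ {n} → (Fin n → ℕ) → ℕ → Subset n
fibre f a = tabulate (λ x → does (f x ≟ a))

∈-fibre⁻ : ∀ {n} (f : Fin n → ℕ) {a y} → y ∈ fibre f a → f y ≡ a
∈-fibre⁻ f {a} {y} y∈ =
  does⇒ (f y ≟ a) (trans (sym (Vecₚ.lookup∘tabulate (λ x → does (f x ≟ a)) y)) (Vecₚ.[]=⇒lookup y∈))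
  where
  does⇒ : ∀ {P : Set} (P? : Dec P) → does P? ≡ true → P
  does⇒ (yes p) _ = p
  does⇒ (no _) ()

∈-fibre⁺ : ∀ {n} (f : Fin n → ℕ) {a y} → f y ≡ a → y ∈ fibre f a
∈-fibre⁺ f {a} {y} fy≡a = Vecₚ.lookup⇒[]= y _ (trans (Vecₚ.lookup∘tabulate _ y) (dec-true (f y ≟ a) fy≡a))

∣p∣≡∣p∩q∣+∣p∩∁q∣ : ∀ {n} (p q : Subset n) → ∣ p ∣ ≡ ∣ p ∩ q ∣ + ∣ p ∩ ∁ q ∣
∣p∣≡∣p∩q∣+∣p∩∁q∣ [] [] = refl
∣p∣≡∣p∩q∣+∣p∩∁q∣ (true ∷ p) (true ∷ q) = cong suc (∣p∣≡∣p∩q∣+∣p∩∁q∣ p q)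
∣p∣≡∣p∩q∣+∣p∩∁q∣ (true ∷ p) (false ∷ q) = trans (cong suc (∣p∣≡∣p∩q∣+∣p∩∁q∣ p q)) (sym (+-suc _ _))
∣p∣≡∣p∩q∣+∣p∩∁q∣ (false ∷ p) (_ ∷ q) = ∣p∣≡∣p∩q∣+∣p∩∁q∣ p q

largeFibre : ∀ {n} k R (S : Subset n) (f : Fin n → ℕ) → (∀ {x} → x ∈ S → f x ≤ R) → k * suc R ≤ ∣ S ∣ →
  ∃[ a ] a ≤ R × k ≤ ∣ S ∩ fibre f a ∣
largeFibre k zero S f f≤0 k≤∣S∣ =
  0 , z≤n , ≤-trans (≤-trans (≤-reflexive (sym (*-identityʳ k))) k≤∣S∣) (p⊆q⇒∣p∣≤∣q∣ S⊆fibre₀)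
  where
  S⊆fibre₀ : S ⊆ S ∩ fibre f 0
  S⊆fibre₀ x∈S = x∈p∩q⁺ (x∈S , ∈-fibre⁺ f (n≤0⇒n≡0 (f≤0 x∈S)))
largeFibre k (suc R) S f f≤1+R k*2+R≤∣S∣ with k ≤? ∣ S ∩ fibre f (suc R) ∣
... | yes k≤ = suc R , ≤-refl , k≤
... | no k≰ with largeFibre k R S′ f f≤R k*1+R≤∣S′∣
  where
  S′ = S ∩ ∁ (fibre f (suc R))
  f≤R : ∀ {x} → x ∈ S′ → f x ≤ R
  f≤R x∈S′ = let x∈S , x∈∁ = x∈p∩q⁻ S _ x∈S′ in
    ≤-pred (≤∧≢⇒< (f≤1+R x∈S) (x∈∁p⇒x∉p x∈∁ ∘ ∈-fibre⁺ f))
  k*1+R≤∣S′∣ : k * suc R ≤ ∣ S′ ∣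
  k*1+R≤∣S′∣ = +-cancelˡ-≤ k _ _ (begin
    k + k * suc R                               ≡⟨ *-suc k (suc R) ⟨
    k * suc (suc R)                             ≤⟨ k*2+R≤∣S∣ ⟩
    ∣ S ∣                                       ≡⟨ ∣p∣≡∣p∩q∣+∣p∩∁q∣ S (fibre f (suc R)) ⟩
    ∣ S ∩ fibre f (suc R) ∣ + ∣ S′ ∣            ≤⟨ +-monoˡ-≤ ∣ S′ ∣ (<⇒≤ (≰⇒> k≰)) ⟩
    k + ∣ S′ ∣                                  ∎)
    where open ≤-Reasoning
...   | a , a≤R , k≤ = a , m≤n⇒m≤1+n a≤R , ≤-trans k≤ (p⊆q⇒∣p∣≤∣q∣ (λ x∈ → let x∈S′ , x∈fibre = x∈p∩q⁻ _ _ x∈ in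
                                                               x∈p∩q⁺ (p∩q⊆p S _ x∈S′ , x∈fibre)))

monochromaticSubset : ∀ {n} k R (S : Subset n) (κ : Fin n → Fin (suc R)) → k * suc R ≤ ∣ S ∣ →
  ∃[ T ] T ⊆ S × k ≤ ∣ T ∣ × ∃[ a ] ∀ {y} → y ∈ T → κ y ≡ a
monochromaticSubset k R S κ k*1+R≤∣S∣ with largeFibre k R S (toℕ ∘ κ) (λ {x} _ → ≤-pred (Finₚ.toℕ<n (κ x))) k*1+R≤∣S∣
... | a , a≤R , k≤ = S ∩ fibre (toℕ ∘ κ) a , p∩q⊆p S _ , k≤ , Fin.fromℕ< (s≤s a≤R) , κ≡a
  where
  κ≡a : ∀ {y} → y ∈ S ∩ fibre (toℕ ∘ κ) a → κ y ≡ Fin.fromℕ< (s≤s a≤R)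
  κ≡a y∈ = Finₚ.toℕ-injective (trans (∈-fibre⁻ (toℕ ∘ κ) (proj₂ (x∈p∩q⁻ S _ y∈))) (sym (Finₚ.toℕ-fromℕ< _)))

StrictlyIncreasing : ∀ {m n} → (Fin m → Fin n) → Set
StrictlyIncreasing h = ∀ {t u} → t Fin.< u → h t Fin.< h u

strictlyIncreasing⇒injective : ∀ {m n} {h : Fin m → Fin n} → StrictlyIncreasing h → Injective _≡_ _≡_ h
strictlyIncreasing⇒injective {h = h} h-inc {t} {u} ht≡hu with Finₚ.<-cmp t u
... | tri< t<u _ _ = ⊥-elim (<⇒≢ (h-inc t<u) (cong toℕ ht≡hu))
... | tri≈ _ t≡u _ = t≡u
... | tri> _ _ u<t = ⊥-elim (<⇒≢ (h-inc u<t) (cong toℕ (sym ht≡hu)))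

enumerate : ∀ {n} (H : Subset n) P → P ≤ ∣ H ∣ →
  Σ (Fin P → Fin n) λ h → (∀ t → h t ∈ H) × StrictlyIncreasing h
enumerate [] zero _ = (λ ()) , (λ ()) , λ { {()} }
enumerate (true ∷ H) zero _ = (λ ()) , (λ ()) , λ { {()} }
enumerate (false ∷ H) P P≤∣H∣ with enumerate H P P≤∣H∣
... | h , h∈H , h-inc = suc ∘ h , there ∘ h∈H , s≤s ∘ h-inc
enumerate (true ∷ H) (suc P) (s≤s P≤∣H∣) with enumerate H P P≤∣H∣
... | h , h∈H , h-inc = h′ , h′∈ , h′-inc
  where
  h′ : Fin (suc P) → Fin _
  h′ zero = zero
  h′ (suc t) = suc (h t)
  h′∈ : ∀ t → h′ t ∈ true ∷ H
  h′∈ zero = here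
  h′∈ (suc t) = there (h∈H t)
  h′-inc : StrictlyIncreasing h′
  h′-inc {zero} {suc u} _ = s≤s z≤n
  h′-inc {suc t} {suc u} (s≤s t<u) = s≤s (h-inc t<u)

Disjoint-sym : ∀ {n} {A B : Subset n} → Disjoint A B → Disjoint B A
Disjoint-sym A#B x x∈B x∈A = A#B x x∈A x∈B

∪-disjoint : ∀ {n} {A B C : Subset n} → Disjoint A C → Disjoint B C → Disjoint (A ∪ B) C
∪-disjoint {A = A} {B} A#C B#C x x∈A∪B x∈C with x∈p∪q⁻ A B x∈A∪B
... | inj₁ x∈A = A#C x x∈A x∈C
... | inj₂ x∈B = B#C x x∈B x∈C

++-disjoint : ∀ {m n} (X X′ : Subset m) {Y Y′ : Subset n} →
  Disjoint X X′ → Disjoint Y Y′ → Disjoint (X ++ Y) (X′ ++ Y′)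
++-disjoint [] [] X#X′ Y#Y′ = Y#Y′
++-disjoint (_ ∷ X) (_ ∷ X′) X#X′ Y#Y′ zero here here = X#X′ zero here here
++-disjoint (_ ∷ X) (_ ∷ X′) X#X′ Y#Y′ (suc x) (there x∈) (there x∈′) =
  ++-disjoint X X′ (λ z z∈ z∈′ → X#X′ (suc z) (there z∈) (there z∈′)) Y#Y′ x x∈ x∈′

⊥#p : ∀ {n} {p : Subset n} → Disjoint ⊥ p
⊥#p x x∈⊥ _ = ∉⊥ x∈⊥

p#⊥ : ∀ {n} {p : Subset n} → Disjoint p ⊥
p#⊥ x _ x∈⊥ = ∉⊥ x∈⊥

++-nonemptyʳ : ∀ {m n} (X : Subset m) {Y : Subset n} → Nonempty Y → Nonempty (X ++ Y)
++-nonemptyʳ [] Y-ne = Y-ne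
++-nonemptyʳ (_ ∷ X) Y-ne = let x , x∈ = ++-nonemptyʳ X Y-ne in suc x , there x∈

++-nonemptyˡ : ∀ {m n} {X : Subset m} (Y : Subset n) → Nonempty X → Nonempty (X ++ Y)
++-nonemptyˡ Y (zero , here) = zero , here
++-nonemptyˡ {X = _ ∷ X} Y (suc x , there x∈) = let z , z∈ = ++-nonemptyˡ Y (x , x∈) in suc z , there z∈

-- Hilbert's cube lemma

-- below s = {0, …, s-1} and between i j = {i, …, j-1}, as subsets of Fin R
below : ∀ {R} → ℕ → Subset R
below {zero} s = []
below {suc R} zero = ⊥
below {suc R} (suc s) = inside ∷ below s

between : ∀ {R} → ℕ → ℕ → Subset R
between {zero} i j = []
between {suc R} zero zero = ⊥
between {suc R} zero (suc j) = inside ∷ between 0 j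
between {suc R} (suc i) zero = ⊥
between {suc R} (suc i) (suc j) = outside ∷ between i j

between-0 : ∀ {R} j → between {R} 0 j ≡ below j
between-0 {zero} j = refl
between-0 {suc R} zero = refl
between-0 {suc R} (suc j) = cong (inside ∷_) (between-0 j)

below-∪-between : ∀ {R} {i j} → i ≤ j → below {R} i ∪ between i j ≡ below j
below-∪-between {zero} _ = refl
below-∪-between {suc R} {zero} {j} _ = trans (∪-identityˡ _) (between-0 j)
below-∪-between {suc R} (s≤s i≤j) = cong (inside ∷_) (below-∪-between i≤j)

below#between : ∀ {R} i j → Disjoint (below {R} i) (between i j)
below#between {suc R} zero j = ⊥#p
below#between {suc R} (suc i) zero = p#⊥
below#between {suc R} (suc i) (suc j) (suc x) (there x∈) (there x∈′) = below#between i j x x∈ x∈′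

between-nonempty : ∀ {R} {i j} → i < j → j ≤ R → Nonempty (between {R} i j)
between-nonempty {suc R} {zero} {suc j} _ _ = zero , here
between-nonempty {suc R} {suc i} {suc j} (s≤s i<j) (s≤s j≤R) =
  let x , x∈ = between-nonempty i<j j≤R in suc x , there x∈

record Cube {n R} (M : ℕ) (c : Subset n → Fin R) : Set where
  field
    F : Subset n
    D : Fin M → Subset n
    D-nonempty : ∀ i → Nonempty (D i)
    F#D : ∀ i → Disjoint F (D i)
    D#D : ∀ i j → i ≢ j → Disjoint (D i) (D j)
    monochromatic : ∀ J → c (F ∪ unionOver D J) ≡ c F

profile : ∀ {n R} → (Subset (n + R) → Fin R) → Subset n → Fin (R ^ suc R)
profile {R = R} c X = Fin.funToFin {suc R} (λ s → c (X ++ below (toℕ s)))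

profile-≡⇒colour-≡ : ∀ {n R} (c : Subset (n + R) → Fin R) {X Y} → profile c X ≡ profile c Y →
  ∀ s → c (X ++ below (toℕ s)) ≡ c (Y ++ below (toℕ s))
profile-≡⇒colour-≡ {R = R} c {X} {Y} profileX≡profileY s = begin
  c (X ++ below (toℕ s))                      ≡⟨ Finₚ.finToFun-funToFin {suc R} (λ s → c (X ++ below (toℕ s))) s ⟨
  Fin.finToFun {R} {suc R} (profile c X) s    ≡⟨ cong (λ v → Fin.finToFun {R} {suc R} v s) profileX≡profileY ⟩
  Fin.finToFun {R} {suc R} (profile c Y) s    ≡⟨ Finₚ.finToFun-funToFin {suc R} (λ s → c (Y ++ below (toℕ s))) s ⟩
  c (Y ++ below (toℕ s))                      ∎
  where open ≡-Reasoning

module CubeExtension {M R nW} (c : Subset (nW + R) → Fin R) (W : Cube M (profile c)) {i j : Fin (suc R)}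
  (i<j : i Fin.< j) (same : c (Cube.F W ++ below (toℕ i)) ≡ c (Cube.F W ++ below (toℕ j))) where
  module W = Cube W

  F : Subset (nW + R)
  F = W.F ++ below (toℕ i)

  D : Fin (suc M) → Subset (nW + R)
  D zero = ⊥ {nW} ++ between (toℕ i) (toℕ j)
  D (suc l) = W.D l ++ ⊥

  D-nonempty : ∀ l → Nonempty (D l)
  D-nonempty zero = ++-nonemptyʳ (⊥ {nW}) (between-nonempty i<j (≤-pred (Finₚ.toℕ<n j)))
  D-nonempty (suc l) = ++-nonemptyˡ ⊥ (W.D-nonempty l)

  F#D : ∀ l → Disjoint F (D l)
  F#D zero = ++-disjoint W.F ⊥ p#⊥ (below#between (toℕ i) (toℕ j))
  F#D (suc l) = ++-disjoint W.F (W.D l) (W.F#D l) p#⊥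

  D#D : ∀ l l′ → l ≢ l′ → Disjoint (D l) (D l′)
  D#D zero zero l≢l′ = ⊥-elim (l≢l′ refl)
  D#D zero (suc l′) _ = ++-disjoint ⊥ (W.D l′) ⊥#p p#⊥
  D#D (suc l) zero _ = ++-disjoint (W.D l) ⊥ p#⊥ ⊥#p
  D#D (suc l) (suc l′) l≢l′ = ++-disjoint (W.D l) (W.D l′) (W.D#D l l′ (l≢l′ ∘ cong suc)) ⊥#p

  corner : ∀ b J → F ∪ unionOver D (b ∷ J) ≡ (W.F ∪ unionOver W.D J) ++ below (toℕ (if b then j else i))
  corner b J = begin
    F ∪ ((if b then ⊥ {nW} ++ Y true else ⊥) ∪ unionOver (D ∘ suc) J)
      ≡⟨ cong₂ (λ X U → F ∪ (X ∪ U)) (⊥-++-if b)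
               (trans (unionOver-++ W.D (λ _ → ⊥) J) (cong (U ++_) (unionOver-⊥ˡ J))) ⟩
    F ∪ ((⊥ {nW} ++ Y b) ∪ (U ++ ⊥ {R}))
      ≡⟨ cong (F ∪_) (trans (∪-++ ⊥ U (Y b) ⊥) (cong₂ _++_ (∪-identityˡ U) (∪-identityʳ (Y b)))) ⟩
    F ∪ (U ++ Y b)
      ≡⟨ ∪-++ W.F U (below (toℕ i)) (Y b) ⟩
    (W.F ∪ U) ++ (below (toℕ i) ∪ Y b)
      ≡⟨ cong ((W.F ∪ U) ++_) (below-∪-Y b) ⟩
    (W.F ∪ U) ++ below (toℕ (if b then j else i)) ∎
    where
    open ≡-Reasoning
    U = unionOver W.D J
    Y : Bool → Subset R
    Y b = if b then between (toℕ i) (toℕ j) else ⊥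
    ⊥-++-if : ∀ b → (if b then ⊥ {nW} ++ Y true else ⊥) ≡ ⊥ {nW} ++ Y b
    ⊥-++-if true = refl
    ⊥-++-if false = ⊥-++ nW
    below-∪-Y : ∀ b → below (toℕ i) ∪ Y b ≡ below (toℕ (if b then j else i))
    below-∪-Y true = below-∪-between (<⇒≤ i<j)
    below-∪-Y false = ∪-identityʳ (below (toℕ i))

  monochromatic : ∀ J → c (F ∪ unionOver D J) ≡ c F
  monochromatic (b ∷ J) = begin
    c (F ∪ unionOver D (b ∷ J))                                  ≡⟨ cong c (corner b J) ⟩
    c ((W.F ∪ unionOver W.D J) ++ below (toℕ (if b then j else i))) ≡⟨ profile-≡⇒colour-≡ c (W.monochromatic J) _ ⟩
    c (W.F ++ below (toℕ (if b then j else i)))                  ≡⟨ at-i b ⟩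
    c F                                                          ∎
    where
    open ≡-Reasoning
    at-i : ∀ b → c (W.F ++ below (toℕ (if b then j else i))) ≡ c F
    at-i true = sym same
    at-i false = refl

  cube : Cube (suc M) c
  cube = record { F = F ; D = D ; D-nonempty = D-nonempty ; F#D = F#D ; D#D = D#D ; monochromatic = monochromatic }

-- Colouring X ⊆ [nW] by its whole profile s ↦ c (X ++ below s) keeps every c (F ++ below s) fixed
-- along the old cube; by pigeonhole two of these R + 1 colours agree, and the difference of the
-- two levels is the new direction.
cube-extend : ∀ {M R nW} → ((c : Subset nW → Fin (R ^ suc R)) → Cube M c) →
  (c : Subset (nW + R) → Fin R) → Cube (suc M) c
cube-extend {R = R} cube c with Finₚ.pigeonhole (n<1+n R) (λ s → c (Cube.F (cube (profile c)) ++ below (toℕ s)))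
... | i , j , i<j , same = CubeExtension.cube c (cube (profile c)) i<j same

hilbertCube : ∀ M R → ∃[ n ] ((c : Subset n → Fin R) → Cube M c)
hilbertCube zero R = 0 , λ c → record
  { F = [] ; D = λ () ; D-nonempty = λ () ; F#D = λ () ; D#D = λ () ; monochromatic = λ { [] → refl } }
hilbertCube (suc M) R = let nW , cube = hilbertCube M (R ^ suc R) in nW + R , cube-extend cube

-- Folkman's theorem

MinDetermined : ∀ {m n R} → (Subset n → Fin R) → (Fin m → Subset n) → Set
MinDetermined {zero} c B = Unit
MinDetermined {suc m} c B = (∀ J → c (B zero ∪ unionOver (B ∘ suc) J) ≡ c (B zero)) × MinDetermined c (B ∘ suc)

minDetermined-unionOver : ∀ {m k n R} (c : Subset n → Fin R) (E : Fin k → Subset n) (K : Fin m → Subset k) →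
  MinDetermined (c ∘ unionOver E) K → MinDetermined c (unionOver E ∘ K)
minDetermined-unionOver {zero} c E K _ = tt
minDetermined-unionOver {suc m} c E K (K₀-determines , K∘suc-md) =
  (λ J → trans (cong c (union J)) (K₀-determines J)) , minDetermined-unionOver c E (K ∘ suc) K∘suc-md
  where
  union : ∀ J → unionOver E (K zero) ∪ unionOver (unionOver E ∘ K ∘ suc) J ≡
                unionOver E (K zero ∪ unionOver (K ∘ suc) J)
  union J = sym (trans (unionOver-∪ E _ _) (cong (unionOver E (K zero) ∪_) (unionOver-unionOver E (K ∘ suc) J)))

minDetermined-colour : ∀ {m n R} (c : Subset n → Fin R) (B : Fin m → Subset n) → MinDetermined c B →
  ∀ J → Nonempty J → ∃[ s ] s ∈ J × c (unionOver B J) ≡ c (B s)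
minDetermined-colour {suc m} c B (B₀-determines , _) (true ∷ J) _ = zero , here , B₀-determines J
minDetermined-colour {suc m} c B (_ , B∘suc-md) (false ∷ J) (suc x , there x∈J)
  with minDetermined-colour c (B ∘ suc) B∘suc-md J (x , x∈J)
... | s , s∈J , colour≡ = suc s , there s∈J , trans (cong c (∪-identityˡ _)) colour≡

record MinDeterminedFamily {n R} (m : ℕ) (c : Subset n → Fin R) : Set where
  field
    B : Fin m → Subset n
    B-nonempty : ∀ i → Nonempty (B i)
    B#B : ∀ i j → i ≢ j → Disjoint (B i) (B j)
    minDetermined : MinDetermined c B

module MinDeterminedExtension {m nG n R} (c : Subset n → Fin R) (C : Cube (suc nG) c)
  (G : MinDeterminedFamily m (c ∘ unionOver (Cube.D C ∘ suc))) where
  module C = Cube C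
  module G = MinDeterminedFamily G

  D′ : Fin nG → Subset n
  D′ = C.D ∘ suc

  B : Fin (suc m) → Subset n
  B zero = C.F ∪ C.D zero
  B (suc i) = unionOver D′ (G.B i)

  B-nonempty : ∀ i → Nonempty (B i)
  B-nonempty zero = let x , x∈D₀ = C.D-nonempty zero in x , x∈p∪q⁺ (inj₂ x∈D₀)
  B-nonempty (suc i) = unionOver-nonempty D′ (G.B i) (C.D-nonempty ∘ suc) (G.B-nonempty i)

  B₀#B : ∀ i → Disjoint (B zero) (B (suc i))
  B₀#B i = ∪-disjoint F#U D₀#U
    where
    F#U : Disjoint C.F (unionOver D′ (G.B i))
    F#U x x∈F x∈U = let j , _ , x∈Dj = ∈-unionOver⁻ D′ (G.B i) x∈U in C.F#D (suc j) x x∈F x∈Dj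
    D₀#U : Disjoint (C.D zero) (unionOver D′ (G.B i))
    D₀#U x x∈D₀ x∈U = let j , _ , x∈Dj = ∈-unionOver⁻ D′ (G.B i) x∈U in C.D#D zero (suc j) (λ ()) x x∈D₀ x∈Dj

  B#B : ∀ i j → i ≢ j → Disjoint (B i) (B j)
  B#B zero zero i≢j = ⊥-elim (i≢j refl)
  B#B zero (suc j) _ = B₀#B j
  B#B (suc i) zero _ = Disjoint-sym (B₀#B i)
  B#B (suc i) (suc j) i≢j = unionOver-disjoint D′ D′#D′ (G.B i) (G.B j) (G.B#B i j (i≢j ∘ cong suc))
    where
    D′#D′ : ∀ i j → i ≢ j → Disjoint (D′ i) (D′ j)
    D′#D′ i j i≢j = C.D#D (suc i) (suc j) (i≢j ∘ Finₚ.suc-injective)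

  B₀-determines : ∀ J → c (B zero ∪ unionOver (B ∘ suc) J) ≡ c (B zero)
  B₀-determines J = begin
    c ((C.F ∪ C.D zero) ∪ unionOver (unionOver D′ ∘ G.B) J)
      ≡⟨ cong (λ U → c ((C.F ∪ C.D zero) ∪ U)) (unionOver-unionOver D′ G.B J) ⟨
    c ((C.F ∪ C.D zero) ∪ unionOver D′ (unionOver G.B J))  ≡⟨ cong c (∪-assoc C.F (C.D zero) _) ⟩
    c (C.F ∪ unionOver C.D (true ∷ unionOver G.B J))       ≡⟨ C.monochromatic (true ∷ unionOver G.B J) ⟩
    c C.F                                                  ≡⟨ C.monochromatic (true ∷ ⊥) ⟨
    c (C.F ∪ (C.D zero ∪ unionOver D′ ⊥))                  ≡⟨ cong (λ U → c (C.F ∪ (C.D zero ∪ U))) (unionOver-⊥ʳ D′) ⟩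
    c (C.F ∪ (C.D zero ∪ ⊥))                               ≡⟨ cong (λ U → c (C.F ∪ U)) (∪-identityʳ (C.D zero)) ⟩
    c (B zero)                                             ∎
    where open ≡-Reasoning

  family : MinDeterminedFamily (suc m) c
  family = record
    { B = B ; B-nonempty = B-nonempty ; B#B = B#B
    ; minDetermined = B₀-determines , minDetermined-unionOver c D′ G.B G.minDetermined }

minDeterminedFamily : ∀ m R → ∃[ n ] ((c : Subset n → Fin R) → MinDeterminedFamily m c)
minDeterminedFamily zero R = 0 , λ c → record { B = λ () ; B-nonempty = λ () ; B#B = λ () ; minDetermined = tt }
minDeterminedFamily (suc m) R =
  let nG , family = minDeterminedFamily m R
      n , cube = hilbertCube (suc nG) R
  in n , λ c → MinDeterminedExtension.family c (cube c) (family (c ∘ unionOver (Cube.D (cube c) ∘ suc)))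

record FolkmanFamily {n R} (k : ℕ) (c : Subset n → Fin R) : Set where
  field
    X : Fin k → Subset n
    X-nonempty : ∀ i → Nonempty (X i)
    X#X : ∀ i j → i ≢ j → Disjoint (X i) (X j)
    colour : Fin R
    monochromatic : ∀ J → Nonempty J → c (unionOver X J) ≡ colour

-- Among k·(R+1) members of a min-determined family, k have the same colour, and then every
-- union of them has that colour too.
folkman : ∀ k R → ∃[ n ] ((c : Subset n → Fin (suc R)) → FolkmanFamily k c)
folkman k R = let n , family = minDeterminedFamily (k * suc R) (suc R) in n , λ c → folkmanFamily c (family c)
  where
  folkmanFamily : ∀ {n} (c : Subset n → Fin (suc R)) → MinDeterminedFamily (k * suc R) c → FolkmanFamily k c
  folkmanFamily c record { B = B ; B-nonempty = B-nonempty ; B#B = B#B ; minDetermined = B-md }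
    with monochromaticSubset k R ⊤ (c ∘ B) (≤-reflexive (sym (∣⊤∣≡n _)))
  ... | T , _ , k≤∣T∣ , a , c∘B≡a with enumerate T k k≤∣T∣
  ...   | h , h∈T , h-inc = record
    { X = B ∘ h ; X-nonempty = B-nonempty ∘ h ; X#X = λ i j i≢j → B#B (h i) (h j) (i≢j ∘ h-inj)
    ; colour = a ; monochromatic = monochromatic }
    where
    h-inj : Injective _≡_ _≡_ h
    h-inj = strictlyIncreasing⇒injective h-inc
    monochromatic : ∀ J → Nonempty J → c (unionOver (B ∘ h) J) ≡ a
    monochromatic J J-ne with minDetermined-colour c B B-md (image h J) (image-nonempty h J J-ne)
    ... | s , s∈hJ , colour≡ with ∈-image⁻ h J s∈hJ
    ...   | t , _ , refl = trans (cong c (sym (unionOver-image B h J))) (trans colour≡ (c∘B≡a (h∈T t)))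

-- Ramsey's theorem for sets

RamseyBound : ∀ R → (∀ {n} → (Subset n → Fin R) → Subset n → Set) → ℕ → ℕ → Set
RamseyBound R P N m = ∀ {n} (S : Subset n) (c : Subset n → Fin R) → N ≤ ∣ S ∣ → ∃[ H ] H ⊆ S × m ≤ ∣ H ∣ × P c H

Ramsey : ∀ R → (∀ {n} → (Subset n → Fin R) → Subset n → Set) → ℕ → Set
Ramsey R P m = ∃[ N ] RamseyBound R P N m

Monochromatic : ∀ {n R} → (Subset n → Fin R) → ℕ → Subset n → Set
Monochromatic c t H = ∃[ a ] ∀ A → A ⊆ H → ∣ A ∣ ≡ t → c A ≡ a

PointDetermined : ∀ {n R} → (Subset n → Fin R) → ℕ → Subset n → Set
PointDetermined {n} {R} c t H = Σ (Fin n → Fin R) λ κ → ∀ A → A ⊆ H → ∣ A ∣ ≡ suc t → ∃[ y ] y ∈ A × c A ≡ κ y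

SizeDetermined : ∀ {n R} → (Subset n → Fin R) → ℕ → Subset n → Set
SizeDetermined c T H = ∀ A B → A ⊆ H → B ⊆ H → ∣ A ∣ ≡ ∣ B ∣ → ∣ A ∣ ≤ T → c A ≡ c B

-- Remove a point x from S, make the colouring A ↦ c (⁅ x ⁆ ∪ A) of t-subsets monochromatic on a
-- large H₁, and recurse inside H₁; x is then put back with that colour.
pointDetermined-extend : ∀ {R t M N N′} →
  RamseyBound R (λ c → PointDetermined c t) N M → RamseyBound R (λ c → Monochromatic c t) N′ N →
  RamseyBound R (λ c → PointDetermined c t) (suc N′) (suc M)
pointDetermined-extend {R} {t} {M} {N} {N′} pd mono S c 1+N′≤∣S∣ with 0<∣p∣⇒nonempty S (≤-trans (s≤s z≤n) 1+N′≤∣S∣)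
... | x , x∈S with mono (S - x) (λ A → c (⁅ x ⁆ ∪ A)) (≤-pred (subst (suc N′ ≤_) (∣p∣≡1+∣p-x∣ x∈S) 1+N′≤∣S∣))
...   | H₁ , H₁⊆S-x , N≤∣H₁∣ , a , H₁-mono with pd H₁ c N≤∣H₁∣
...     | H₂ , H₂⊆H₁ , M≤∣H₂∣ , κ₂ , H₂-pd = ⁅ x ⁆ ∪ H₂ , H⊆S , 1+M≤∣H∣ , κ , H-pd
  where
  x∉H₂ : x ∉ H₂
  x∉H₂ x∈H₂ = x∈p─q⇒x∉q {p = S} (H₁⊆S-x (H₂⊆H₁ x∈H₂)) (x∈⁅x⁆ x)
  H⊆S : ⁅ x ⁆ ∪ H₂ ⊆ S
  H⊆S {y} y∈H with y Fin.≟ x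
  ... | yes refl = x∈S
  ... | no y≢x = p─q⊆p S ⁅ x ⁆ (H₁⊆S-x (H₂⊆H₁ (x∈⁅y⁆∪p∧x≢y⇒x∈p {p = H₂} y∈H y≢x)))
  1+M≤∣H∣ : suc M ≤ ∣ ⁅ x ⁆ ∪ H₂ ∣
  1+M≤∣H∣ = subst (suc M ≤_) (sym (∣⁅x⁆∪p∣ H₂ x∉H₂)) (s≤s M≤∣H₂∣)
  κ : Fin _ → Fin R
  κ y = if does (y Fin.≟ x) then a else κ₂ y
  H-pd : ∀ A → A ⊆ ⁅ x ⁆ ∪ H₂ → ∣ A ∣ ≡ suc t → ∃[ y ] y ∈ A × c A ≡ κ y
  H-pd A A⊆H ∣A∣≡1+t with x ∈? A
  ... | yes x∈A = x , x∈A , (begin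
    c A                ≡⟨ cong c (p≡⁅x⁆∪p-x x∈A) ⟩
    c (⁅ x ⁆ ∪ (A - x)) ≡⟨ H₁-mono (A - x) A-x⊆H₁ (suc-injective (trans (sym (∣p∣≡1+∣p-x∣ x∈A)) ∣A∣≡1+t)) ⟩
    a                  ≡⟨ cong (if_then a else κ₂ x) (dec-true (x Fin.≟ x) refl) ⟨
    κ x                ∎)
    where
    open ≡-Reasoning
    A-x⊆H₁ : A - x ⊆ H₁
    A-x⊆H₁ y∈A-x = H₂⊆H₁ (x∈⁅y⁆∪p∧x≢y⇒x∈p {p = H₂} (A⊆H (p─q⊆p A ⁅ x ⁆ y∈A-x)) (x∉⁅y⁆⇒x≢y (x∈p─q⇒x∉q {p = A} y∈A-x)))
  ... | no x∉A with H₂-pd A (λ y∈A → x∈⁅y⁆∪p∧x≢y⇒x∈p {p = H₂} (A⊆H y∈A) (λ { refl → x∉A y∈A })) ∣A∣≡1+t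
  ...   | y , y∈A , cA≡κ₂y = y , y∈A , trans cA≡κ₂y (cong (if_then a else κ₂ y) (sym (dec-false (y Fin.≟ x) y≢x)))
    where
    y≢x : y ≢ x
    y≢x refl = x∉A y∈A

pointDetermined : ∀ {R t} → (∀ m → Ramsey R (λ c → Monochromatic c t) m) →
  ∀ M → Ramsey R (λ c → PointDetermined c t) M
pointDetermined ramsey zero = 0 , λ {n} S c _ → ⊥ , (⊥-elim ∘ ∉⊥) , z≤n , (λ _ → c ⊥) , λ A A⊆⊥ ∣A∣≡1+t →
  ⊥-elim (0≢1+n (trans (sym (trans (cong ∣_∣ (⊆-antisym A⊆⊥ ⊥⊆)) (∣⊥∣≡0 n))) ∣A∣≡1+t))
pointDetermined ramsey (suc M) =
  let N , pd = pointDetermined ramsey M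
      N′ , mono = ramsey N
  in suc N′ , pointDetermined-extend pd mono

ramsey : ∀ R t m → Ramsey (suc R) (λ c → Monochromatic c t) m
ramsey R zero m = m , λ S c m≤∣S∣ → S , (λ x∈ → x∈) , m≤∣S∣ , c ⊥ , λ A _ ∣A∣≡0 → cong c (∣p∣≡0⇒p≡⊥ ∣A∣≡0)
ramsey R (suc t) m = let N , pd = pointDetermined (ramsey R t) (m * suc R) in N , mono pd
  where
  mono : ∀ {N} → RamseyBound (suc R) (λ c → PointDetermined c t) N (m * suc R) →
    RamseyBound (suc R) (λ c → Monochromatic c (suc t)) N m
  mono pd S c N≤∣S∣ with pd S c N≤∣S∣
  ... | H , H⊆S , m*1+R≤∣H∣ , κ , H-pd with monochromaticSubset m R H κ m*1+R≤∣H∣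
  ...   | T , T⊆H , m≤∣T∣ , a , κ≡a = T , (H⊆S ∘ T⊆H) , m≤∣T∣ , a , T-mono
    where
    T-mono : ∀ A → A ⊆ T → ∣ A ∣ ≡ suc t → c A ≡ a
    T-mono A A⊆T ∣A∣≡1+t = let y , y∈A , cA≡κy = H-pd A (T⊆H ∘ A⊆T) ∣A∣≡1+t in trans cA≡κy (κ≡a (A⊆T y∈A))

sizeDetermined : ∀ R T m → Ramsey (suc R) (λ c → SizeDetermined c T) m
sizeDetermined R zero m = m , λ S c m≤∣S∣ → S , (λ x∈ → x∈) , m≤∣S∣ , λ A B _ _ ∣A∣≡∣B∣ ∣A∣≤0 →
  cong c (trans (∣p∣≡0⇒p≡⊥ (n≤0⇒n≡0 ∣A∣≤0)) (sym (∣p∣≡0⇒p≡⊥ (trans (sym ∣A∣≡∣B∣) (n≤0⇒n≡0 ∣A∣≤0)))))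
sizeDetermined R (suc T) m =
  let N , mono = ramsey R (suc T) m
      N′ , sd = sizeDetermined R T N
  in N′ , λ S c N′≤∣S∣ →
    let H₁ , H₁⊆S , N≤∣H₁∣ , H₁-sd = sd S c N′≤∣S∣
        H₂ , H₂⊆H₁ , m≤∣H₂∣ , H₂-mono = mono H₁ c N≤∣H₁∣
    in H₂ , (H₁⊆S ∘ H₂⊆H₁) , m≤∣H₂∣ , H₂-sd H₁-sd H₂⊆H₁ H₂-mono
  where
  H₂-sd : ∀ {n} {c : Subset n → Fin (suc R)} {H₁ H₂} → SizeDetermined c T H₁ → H₂ ⊆ H₁ →
    Monochromatic c (suc T) H₂ → SizeDetermined c (suc T) H₂
  H₂-sd H₁-sd H₂⊆H₁ (a , H₂-mono) A B A⊆H₂ B⊆H₂ ∣A∣≡∣B∣ ∣A∣≤1+T with ∣ A ∣ ≤? T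
  ... | yes ∣A∣≤T = H₁-sd A B (H₂⊆H₁ ∘ A⊆H₂) (H₂⊆H₁ ∘ B⊆H₂) ∣A∣≡∣B∣ ∣A∣≤T
  ... | no ∣A∣≰T = let ∣A∣≡1+T = ≤-antisym ∣A∣≤1+T (≰⇒> ∣A∣≰T) in
    trans (H₂-mono A A⊆H₂ ∣A∣≡1+T) (sym (H₂-mono B B⊆H₂ (trans (sym ∣A∣≡∣B∣) ∣A∣≡1+T)))

-- Placing the blocks by size

sizeDetermined-image : ∀ {m n R} {c : Subset n → Fin R} {H} → SizeDetermined c m H →
  (f g : Fin m → Fin n) → Injective _≡_ _≡_ f → Injective _≡_ _≡_ g → (∀ x → f x ∈ H) → (∀ x → g x ∈ H) →
  ∀ A → c (image f A) ≡ c (image g A)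
sizeDetermined-image H-sd f g f-inj g-inj f∈H g∈H A =
  H-sd (image f A) (image g A) (image-⊆ f f∈H A) (image-⊆ g g∈H A)
    (trans (∣image∣ f f-inj A) (sym (∣image∣ g g-inj A))) (≤-trans (≤-reflexive (∣image∣ f f-inj A)) (∣p∣≤n A))

blockSize : ∀ {k m} → (Fin k → Subset m) → Fin m → ℕ
blockSize {zero} X x = 0
blockSize {suc k} X x with x ∈? X zero
... | yes _ = ∣ X zero ∣
... | no _ = blockSize (X ∘ suc) x

blockSize-∈ : ∀ {k m} (X : Fin k → Subset m) → (∀ i j → i ≢ j → Disjoint (X i) (X j)) →
  ∀ i {x} → x ∈ X i → blockSize X x ≡ ∣ X i ∣
blockSize-∈ {suc k} X X#X i {x} x∈Xi with x ∈? X zero | i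
... | yes _ | zero = refl
... | yes x∈X₀ | suc i = ⊥-elim (X#X zero (suc i) (λ ()) x x∈X₀ x∈Xi)
... | no x∉X₀ | zero = ⊥-elim (x∉X₀ x∈Xi)
... | no _ | suc i = blockSize-∈ (X ∘ suc) (λ i j i≢j → X#X (suc i) (suc j) (i≢j ∘ Finₚ.suc-injective)) i x∈Xi

-- x goes to row m ∸ (size of its block) and column x, so larger blocks occupy earlier rows.
rank : ∀ {k m} → (Fin k → Subset m) → Fin m → Fin (suc m)
rank {m = m} X x = Fin.fromℕ< (s≤s (m∸n≤m m (blockSize X x)))

position : ∀ {k m} → (Fin k → Subset m) → Fin m → Fin (suc m * m)
position X x = Fin.combine (rank X x) x

position-injective : ∀ {k m} (X : Fin k → Subset m) → Injective _≡_ _≡_ (position X)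
position-injective X {x} {y} = Finₚ.combine-injectiveʳ (rank X x) x (rank X y) y

position-separates : ∀ {k m} (X : Fin k → Subset m) → (∀ i j → i ≢ j → Disjoint (X i) (X j)) →
  ∀ t u → ∣ X u ∣ < ∣ X t ∣ → ∀ {x y} → x ∈ X t → y ∈ X u → position X x Fin.< position X y
position-separates {m = m} X X#X t u ∣Xu∣<∣Xt∣ {x} {y} x∈Xt y∈Xu = Finₚ.combine-monoˡ-< x y (begin-strict
  toℕ (rank X x)      ≡⟨ Finₚ.toℕ-fromℕ< _ ⟩
  m ∸ blockSize X x   ≡⟨ cong (m ∸_) (blockSize-∈ X X#X t x∈Xt) ⟩
  m ∸ ∣ X t ∣         <⟨ ∸-monoʳ-< ∣Xu∣<∣Xt∣ (∣p∣≤n (X t)) ⟩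
  m ∸ ∣ X u ∣         ≡⟨ cong (m ∸_) (blockSize-∈ X X#X u y∈Xu) ⟨
  m ∸ blockSize X y   ≡⟨ Finₚ.toℕ-fromℕ< _ ⟨
  toℕ (rank X y)      ∎)
  where open ≤-Reasoning

SizeSeparated : ∀ {k n} → (Fin k → Subset n) → Set
SizeSeparated I = ∀ t u → ∣ I u ∣ < ∣ I t ∣ → ∀ {x y} → x ∈ I t → y ∈ I u → x Fin.< y

record SeparatedFolkmanFamily {n R} (k : ℕ) (c : Subset n → Fin R) : Set where
  field
    family : FolkmanFamily k c
  open FolkmanFamily family public
  field
    sizeSeparated : SizeSeparated X

module Separation {m n R k} (c : Subset n → Fin R) {H} (H-sd : SizeDetermined c m H)
  (h : Fin (suc m * m) → Fin n) (h∈H : ∀ t → h t ∈ H) (h-inc : StrictlyIncreasing h)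
  (folkmanFamily : (c : Subset m → Fin R) → FolkmanFamily k c) where

  h-inj : Injective _≡_ _≡_ h
  h-inj = strictlyIncreasing⇒injective h-inc

  identity : Fin m → Fin n
  identity = h ∘ Fin.combine {suc m} zero

  identity-inj : Injective _≡_ _≡_ identity
  identity-inj {x} {y} = Finₚ.combine-injectiveʳ {suc m} zero x zero y ∘ h-inj

  module F = FolkmanFamily (folkmanFamily (c ∘ image identity))

  f : Fin m → Fin n
  f = h ∘ position F.X

  f-inj : Injective _≡_ _≡_ f
  f-inj = position-injective F.X ∘ h-inj

  monochromatic : ∀ J → Nonempty J → c (unionOver (image f ∘ F.X) J) ≡ F.colour
  monochromatic J J-ne = begin
    c (unionOver (image f ∘ F.X) J)      ≡⟨ cong c (unionOver-unionOver (⁅_⁆ ∘ f) F.X J) ⟨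
    c (image f (unionOver F.X J))
      ≡⟨ sizeDetermined-image H-sd f identity f-inj identity-inj (h∈H ∘ _) (h∈H ∘ _) _ ⟩
    c (image identity (unionOver F.X J)) ≡⟨ F.monochromatic J J-ne ⟩
    F.colour                             ∎
    where open ≡-Reasoning

  sizeSeparated : SizeSeparated (image f ∘ F.X)
  sizeSeparated t u ∣Iu∣<∣It∣ x∈It y∈Iu with ∈-image⁻ f (F.X t) x∈It | ∈-image⁻ f (F.X u) y∈Iu
  ... | x , x∈Xt , refl | y , y∈Xu , refl = h-inc (position-separates F.X F.X#X t u ∣Xu∣<∣Xt∣ x∈Xt y∈Xu)
    where
    ∣Xu∣<∣Xt∣ : ∣ F.X u ∣ < ∣ F.X t ∣
    ∣Xu∣<∣Xt∣ = subst₂ _<_ (∣image∣ f f-inj (F.X u)) (∣image∣ f f-inj (F.X t)) ∣Iu∣<∣It∣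

  family : SeparatedFolkmanFamily k c
  family = record
    { family = record
      { X = image f ∘ F.X ; X-nonempty = λ i → image-nonempty f (F.X i) (F.X-nonempty i)
      ; X#X = λ i j i≢j → image-disjoint f f-inj (F.X i) (F.X j) (F.X#X i j i≢j)
      ; colour = F.colour ; monochromatic = monochromatic }
    ; sizeSeparated = sizeSeparated }

-- Folkman's theorem is applied to [m] coloured through the placement x ↦ (row 0, column x) into a
-- size-determined set H; moving each element to its position instead changes no colour, because
-- the colour on H only depends on the size.
separatedFolkman : ∀ k R → ∃[ n ] ((c : Subset n → Fin (suc R)) → SeparatedFolkmanFamily k c)
separatedFolkman k R =
  let m , folkmanFamily = folkman k R
      n , sizeDeterminedSubset = sizeDetermined R m (suc m * m)
  in n , λ c → let H , _ , ∣H∣ , H-sd = sizeDeterminedSubset ⊤ c (≤-reflexive (sym (∣⊤∣≡n n)))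
                   h , h∈H , h-inc = enumerate H (suc m * m) ∣H∣
               in Separation.family c H-sd h h∈H h-inc folkmanFamily

-- Top members of families

max : ∀ {n} (A : Subset n) → Nonempty A → ∃[ x ] IsMax A x
max {suc n} (b ∷ A) A-ne with nonempty? A
... | no tail-empty = zero , zero∈ A-ne , is-max
  where
  zero∈ : Nonempty (b ∷ A) → zero ∈ b ∷ A
  zero∈ (zero , zero∈bA) = zero∈bA
  zero∈ (suc y , there y∈A) = ⊥-elim (tail-empty (y , y∈A))
  is-max : ∀ y → y ∈ b ∷ A → y Fin.≤ zero {n}
  is-max zero _ = z≤n
  is-max (suc y) (there y∈A) = ⊥-elim (tail-empty (y , y∈A))
... | yes tail-ne with max A tail-ne
...   | x , x∈A , x-max = suc x , there x∈A , is-max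
  where
  is-max : ∀ y → y ∈ b ∷ A → y Fin.≤ suc x
  is-max zero _ = z≤n
  is-max (suc y) (there y∈A) = s≤s (x-max y y∈A)

IsMax-unique : ∀ {n} {A : Subset n} {x y} → IsMax A x → IsMax A y → x ≡ y
IsMax-unique (x∈A , x-max) (y∈A , y-max) = Finₚ.≤-antisym (y-max _ x∈A) (x-max _ y∈A)

top : ∀ {n} (L : List (Subset n)) → IsFamily L → ∃[ F ] IsTop L F
top [] (L≢[] , _) = ⊥-elim (L≢[] refl)
top (I ∷ []) (_ , I-ne All.∷ All.[] , _) =
  let x , x-max = max I I-ne in I , here refl , x , x-max , λ { I′ (here I′≡I) I′≢I → ⊥-elim (I′≢I I′≡I) }
top (I ∷ I₂ ∷ L) (_ , I-ne All.∷ L-ne , I#L AllPairs.∷ L-dis) with top (I₂ ∷ L) ((λ ()) , L-ne , L-dis)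
... | F , F∈L , x , x-max , F-top with max I I-ne
...   | z , z-max with Finₚ.<-cmp z x
...     | tri< z<x _ _ = F , there F∈L , x , x-max , F-top′
  where
  F-top′ : ∀ I′ → I′ LM.∈ I ∷ I₂ ∷ L → I′ ≢ F → ∀ y → IsMax I′ y → y Fin.< x
  F-top′ I′ (here refl) _ y y-max = subst (Fin._< x) (IsMax-unique z-max y-max) z<x
  F-top′ I′ (there I′∈L) I′≢F = F-top I′ I′∈L I′≢F
...     | tri≈ _ refl _ = ⊥-elim (All.lookup I#L F∈L z (proj₁ z-max) (proj₁ x-max))
...     | tri> _ _ x<z = I , here refl , z , z-max , I-top
  where
  I-top : ∀ I′ → I′ LM.∈ I ∷ I₂ ∷ L → I′ ≢ I → ∀ y → IsMax I′ y → y Fin.< z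
  I-top I′ (here I′≡I) I′≢I = ⊥-elim (I′≢I I′≡I)
  I-top I′ (there I′∈L) _ y y-max with Vecₚ.≡-dec Boolₚ._≟_ I′ F
  ... | yes refl = subst (Fin._< z) (IsMax-unique x-max y-max) x<z
  ... | no I′≢F = Finₚ.<-trans (F-top I′ I′∈L I′≢F y y-max) x<z

SeparatedBySize : ∀ {n} → Subset n → Subset n → Set
SeparatedBySize X Y = ∣ Y ∣ < ∣ X ∣ → ∀ {x y} → x ∈ X → y ∈ Y → x Fin.< y

top-smallest : ∀ {n} {L : List (Subset n)} {F} → (∀ {X Y} → X LM.∈ L → Y LM.∈ L → SeparatedBySize X Y) →
  IsFamily L → IsTop L F → All (λ X → ∣ F ∣ ≤ ∣ X ∣) L
top-smallest {L = L} {F} separated (_ , L-ne , _) (F∈L , x , x-max , F-top) = All.tabulate F-smallest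
  where
  F-smallest : ∀ {X} → X LM.∈ L → ∣ F ∣ ≤ ∣ X ∣
  F-smallest {X} X∈L with ∣ F ∣ ≤? ∣ X ∣
  ... | yes ∣F∣≤∣X∣ = ∣F∣≤∣X∣
  ... | no ∣F∣≰∣X∣ with max X (All.lookup L-ne X∈L)
  ...   | y , y-max =
    ⊥-elim (Finₚ.<-asym (F-top X X∈L X≢F y y-max) (separated F∈L X∈L ∣X∣<∣F∣ (proj₁ x-max) (proj₁ y-max)))
    where
    ∣X∣<∣F∣ : ∣ X ∣ < ∣ F ∣
    ∣X∣<∣F∣ = ≰⇒> ∣F∣≰∣X∣
    X≢F : X ≢ F
    X≢F refl = <-irrefl refl ∣X∣<∣F∣

∣p∣≡1⇒p≡⁅x⁆ : ∀ {n} (p : Subset n) → ∣ p ∣ ≡ 1 → ∃[ x ] p ≡ ⁅ x ⁆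
∣p∣≡1⇒p≡⁅x⁆ (true ∷ p) ∣p∣≡1 = zero , cong (inside ∷_) (∣p∣≡0⇒p≡⊥ (suc-injective ∣p∣≡1))
∣p∣≡1⇒p≡⁅x⁆ (false ∷ p) ∣p∣≡1 = let x , p≡⁅x⁆ = ∣p∣≡1⇒p≡⁅x⁆ p ∣p∣≡1 in suc x , cong (outside ∷_) p≡⁅x⁆

extreme-separated : ∀ {k n} (I : Fin k → Subset n) → SizeSeparated I → ∀ {J} → IsExtreme J →
  ∀ {X Y} → X LM.∈ map (unionOver I) J → Y LM.∈ map (unionOver I) J → SeparatedBySize X Y
extreme-separated I I-sep {A ∷ []} (inj₁ _) (here refl) (here refl) ∣X∣<∣X∣ = ⊥-elim (<-irrefl refl ∣X∣<∣X∣)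
extreme-separated I I-sep (inj₂ singletons) X∈ Y∈ with ∈-map⁻ (unionOver I) X∈ | ∈-map⁻ (unionOver I) Y∈
... | A , A∈J , refl | B , B∈J , refl
  with ∣p∣≡1⇒p≡⁅x⁆ A (All.lookup singletons A∈J) | ∣p∣≡1⇒p≡⁅x⁆ B (All.lookup singletons B∈J)
...   | t , refl | u , refl rewrite unionOver-⁅⁆ I t | unionOver-⁅⁆ I u = I-sep t u

unionOver-family : ∀ {k n} (I : Fin k → Subset n) → (∀ i → Nonempty (I i)) → (∀ i j → i ≢ j → Disjoint (I i) (I j)) →
  ∀ {J} → IsFamily J → IsFamily (map (unionOver I) J)
unionOver-family I I-ne I#I {[]} (J≢[] , _) = ⊥-elim (J≢[] refl)
unionOver-family I I-ne I#I {A ∷ J} (_ , J-ne , J-dis) =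
  (λ ()) , Allₚ.map⁺ (All.map (unionOver-nonempty I _ I-ne) J-ne) ,
  AllPairsₚ.map⁺ (AllPairs.map (unionOver-disjoint I I#I _ _) J-dis)

module _ {n r k} (C′ : List (Subset n) → Fin r) (c : Subset n → Fin r)
  (C′≡c∘top : ∀ L F → IsFamily L → IsTop L F → All (λ I′ → ∣ F ∣ ≤ ∣ I′ ∣) L → C′ L ≡ c F)
  (I : SeparatedFolkmanFamily k c) where
  open SeparatedFolkmanFamily I

  X-family : ∀ {J} → IsFamily J → IsFamily (map (unionOver X) J)
  X-family = unionOver-family X X-nonempty X#X

  separated-extreme-monochromatic : ∀ J → IsFamily J → IsExtreme J → C′ (map (unionOver X) J) ≡ colour
  separated-extreme-monochromatic J J-fam@(_ , J-ne , _) J-ext with top (map (unionOver X) J) (X-family J-fam)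
  ... | F , F-top@(F∈L , _) with ∈-map⁻ (unionOver X) F∈L
  ...   | A , A∈J , refl = begin
    C′ (map (unionOver X) J)
      ≡⟨ C′≡c∘top _ _ (X-family J-fam) F-top
           (top-smallest (extreme-separated X sizeSeparated J-ext) (X-family J-fam) F-top) ⟩
    c (unionOver X A)
      ≡⟨ monochromatic A (All.lookup J-ne A∈J) ⟩
    colour                   ∎
    where open ≡-Reasoning

lemma2p4 : (r k : ℕ) → NonZero r → NonZero k →
    Σ ℕ λ n →
    (C' : List (Subset n) → Fin r) →
    (∀ L L' → L ↭ L' → C' L ≡ C' L') →
    (c : Subset n → Fin r) →
    (∀ L F → IsFamily L → IsTop L F → All (λ I' → ∣ F ∣ Data.Nat.≤ ∣ I' ∣) L → C' L ≡ c F) →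
    Σ (Fin k → Subset n) λ I →
    (∀ i → Data.Fin.Subset.Nonempty (I i)) ×
    (∀ i j → i ≢ j → Disjoint (I i) (I j)) ×
    Σ (Fin r) λ χ →
    ∀ J → IsFamily J → IsExtreme J → C' (map (unionOver I) J) ≡ χ
lemma2p4 zero k r≢0 _ = ⊥-elim (NonZero.nonZero r≢0)
lemma2p4 (suc r) k _ _ = let n , separatedFamily = separatedFolkman k r in
  n , λ C′ _ c C′≡c∘top → let open SeparatedFolkmanFamily (separatedFamily c) in
    X , X-nonempty , X#X , colour , separated-extreme-monochromatic C′ c C′≡c∘top (separatedFamily c)
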